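{- Let $n\ge2$, $m>1$ and $T\in\mathrm{Bi}(m,n)$. Then there exists an external vertex $v$ of $T$ such that $|\operatorname{Two}(v)|=n-1$.
   Context: $\mathrm{Bi}(m,n)$ denotes the set of finite trees all of whose vertices have valence $1$ or $n$ and which have exactly $m$ vertices of valence $n$. External vertices are vertices of valence $1$. For an external vertex $v$, $\operatorname{Two}(v)$ is the set of external vertices at (graph) distance at most $2$ from $v$ (so $v\in\operatorname{Two}(v)$). -}

module Defs where

open import Data.Nat using (ℕ; _≤_; _≡ᵇ_)
open import Data.Fin using (Fin)
open import Data.Fin.Properties using (_≟_)
open import Data.Bool using (Bool; T; _∧_; _∨_)
open import Data.List using (List; []; _∷_; _++_; length; filterᵇ)
open import Data.Bool.ListAction using (any)
open import Data.List.Relation.Unary.Unique.Propositional using (Unique)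
open import Data.Product using (Σ; _×_)
open import Data.Sum
open import Data.Unit using (⊤)
open import Relation.Binary.PropositionalEquality using (_≡_)
open import Relation.Nullary using (¬_)
open import Relation.Nullary.Decidable using (⌊_⌋)

record Graph (N : ℕ) : Set where
  field
    adj   : Fin N → Fin N → Bool
    sym   : ∀ u v → adj u v ≡ adj v u
    irref : ∀ v → adj v v ≡ Data.Bool.false

open Graph public

allV : (N : ℕ) → List (Fin N)
allV N = Data.List.allFin N

module _ {N : ℕ} (G : Graph N) where

  Chain : List (Fin N) → Set
  Chain [] = ⊤
  Chain (x ∷ []) = ⊤
  Chain (x ∷ y ∷ r) = T (adj G x y) × Chain (y ∷ r)

  lastOf : Fin N → List (Fin N) → Fin N
  lastOf x [] = x
  lastOf x (y ∷ r) = lastOf y r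

  Connected : Set
  Connected = ∀ u v → Σ (List (Fin N)) λ xs → Chain (u ∷ xs) × lastOf u xs ≡ v

  HasCycle : Set
  HasCycle = Σ (Fin N) λ x → Σ (List (Fin N)) λ ys →
    Unique (x ∷ ys) × 2 ≤ length ys × Chain (x ∷ ys ++ x ∷ [])

  IsTree : Set
  IsTree = Connected × ¬ HasCycle

  valence : Fin N → ℕ
  valence v = length (filterᵇ (adj G v) (allV N))

  isExternalᵇ : Fin N → Bool
  isExternalᵇ v = valence v ≡ᵇ 1

  within2ᵇ : Fin N → Fin N → Bool
  within2ᵇ u w = ⌊ u ≟ w ⌋ ∨ adj G u w ∨ any (λ z → adj G u z ∧ adj G z w) (allV N)

  Two : Fin N → List (Fin N)
  Two v = filterᵇ (λ w → isExternalᵇ w ∧ within2ᵇ v w) (allV N)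

  InBi : ℕ → ℕ → Set
  InBi m n = IsTree
           × (∀ v → valence v ≡ 1 Data.Sum.⊎ valence v ≡ n)
           × length (filterᵇ (λ v → valence v ≡ᵇ n) (allV N)) ≡ m

-- Call the vertices of valence n internal. As m ≥ 2 and T is connected, some internal
-- vertex has an internal neighbour; walking on from it through internal vertices without
-- backtracking must stop, since T is finite and acyclic. It stops at an internal p with a
-- single internal neighbour q, so the other n − 1 neighbours of p are external. For any of
-- them, v, the vertices within distance 2 of v are v, p and the neighbours of p, so Two(v)
-- consists exactly of these n − 1 external neighbours.

{-# OPTIONS --safe #-}
module Submission where

open import Data.Bool using (Bool; true; false; T; _∧_)
open import Data.Bool.Properties using (T?; T-∧)
open import Data.Empty using (⊥-elim)
open import Data.Fin as Fin using (Fin)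
open import Data.Fin.Properties using (_≟_; any?; injective⇒≤)
open import Data.List using (List; []; _∷_; _++_; length; filter; filterᵇ; lookup)
open import Data.List.Membership.Propositional using (_∈_; lose)
open import Data.List.Membership.Propositional.Properties
  using (∈-allFin; ∈-filter⁺; ∈-filter⁻; ∈-∃++; ∈-++⁺ʳ; ∈-lookup)
open import Data.List.Properties using (filter-accept; filter-reject; filter-≐)
open import Data.List.Relation.Unary.All as All using (All; []; _∷_)
open import Data.List.Relation.Unary.All.Properties using (++⁻ˡ; ¬Any⇒All¬)
open import Data.List.Relation.Unary.Any using (here; there; satisfied)
open import Data.List.Relation.Unary.Any.Properties using (any⁺; any⁻)
open import Data.List.Relation.Unary.Unique.Propositional using (Unique; []; _∷_)
open import Data.List.Relation.Unary.Unique.Propositional.Properties using (allFin⁺; filter⁺)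
open import Data.Nat using (ℕ; zero; suc; _+_; _∸_; _≤_; _<_; z≤n; s≤s; _≡ᵇ_)
open import Data.Nat.Properties
  using (≡ᵇ⇒≡; ≡⇒≡ᵇ; +-suc; m≤m+n; m+n≤o⇒n≤o; 1+n≰n; ≤-trans; <⇒≢; ∸-monoˡ-≤)
import Data.Nat.Properties as ℕ
open import Data.Product using (Σ; ∃; ∃₂; _×_; _,_; proj₁; proj₂)
open import Data.Sum using (_⊎_; inj₁; inj₂)
open import Data.Unit using (tt)
open import Function using (Injective; _∘_; Equivalence; _⇔_; mk⇔)
open import Level using (Level)
open import Relation.Binary.PropositionalEquality using (_≡_; _≢_; refl; sym; trans; cong; subst)
open import Relation.Nullary using (¬_; yes; no; ¬?)
open import Relation.Nullary.Decidable using (_×-dec_; decidable-stable)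
open import Relation.Unary using (Pred; Decidable; _⊆_)

open import Defs hiding (sym)

private variable
  a ℓ : Level
  A : Set a

∈-length≡1⇒≡ : ∀ {xs} {x y : A} → length xs ≡ 1 → x ∈ xs → y ∈ xs → x ≡ y
∈-length≡1⇒≡ {xs = _ ∷ []} _ (here refl) (here refl) = refl

length>0⇒∈ : ∀ {xs : List A} → 0 < length xs → ∃ λ x → x ∈ xs
length>0⇒∈ {xs = x ∷ _} _ = x , here refl

Unique-two : ∀ {xs : List A} → Unique xs → 2 ≤ length xs → ∃₂ λ x y → x ≢ y × x ∈ xs × y ∈ xs
Unique-two {xs = x ∷ y ∷ _} ((x≢y ∷ _) ∷ _) (s≤s (s≤s _)) = x , y , x≢y , here refl , there (here refl)

Unique-prefix : ∀ xs {z : A} {ys} → Unique (xs ++ z ∷ ys) → Unique (z ∷ xs)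
Unique-prefix []       (_ ∷ _)       = [] ∷ []
Unique-prefix (x ∷ xs) (x∉ ∷ unique) with z∉xs ∷ xs-unique ← Unique-prefix xs unique =
  (x≢z ∘ sym ∷ z∉xs) ∷ ++⁻ˡ xs x∉ ∷ xs-unique
  where x≢z = All.lookup x∉ (∈-++⁺ʳ xs (here refl))

lookup-injective : ∀ {xs : List A} → Unique xs → Injective _≡_ _≡_ (lookup xs)
lookup-injective (_ ∷ _)      {Fin.zero}  {Fin.zero}  _ = refl
lookup-injective (x∉ ∷ _)     {Fin.zero}  {Fin.suc j} e = ⊥-elim (All.lookup x∉ (∈-lookup j) e)
lookup-injective (x∉ ∷ _)     {Fin.suc i} {Fin.zero}  e = ⊥-elim (All.lookup x∉ (∈-lookup i) (sym e))
lookup-injective (_ ∷ unique) {Fin.suc i} {Fin.suc j} e = cong Fin.suc (lookup-injective unique e)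

Unique⇒length≤ : ∀ {N} {xs : List (Fin N)} → Unique xs → length xs ≤ N
Unique⇒length≤ unique = injective⇒≤ (lookup-injective unique)

module _ {P Q : Pred A ℓ} (P? : Decidable P) (Q? : Decidable Q) where

  filter-cong-∈ : ∀ {xs} → (∀ {y} → y ∈ xs → P y → Q y) → (∀ {y} → y ∈ xs → Q y → P y) →
                  filter P? xs ≡ filter Q? xs
  filter-cong-∈ {[]}     _   _   = refl
  filter-cong-∈ {x ∷ xs} P⇒Q Q⇒P with P? x
  ... | yes Px = trans (cong (x ∷_) (filter-cong-∈ (P⇒Q ∘ there) (Q⇒P ∘ there)))
                       (sym (filter-accept Q? (P⇒Q (here refl) Px)))
  ... | no ¬Px = trans (filter-cong-∈ (P⇒Q ∘ there) (Q⇒P ∘ there))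
                       (sym (filter-reject Q? (¬Px ∘ Q⇒P (here refl))))

  length-filter-except : ∀ {x xs} → Unique xs → x ∈ xs → P x → ¬ Q x → Q ⊆ P →
                         (∀ {y} → P y → y ≢ x → Q y) →
                         length (filter P? xs) ≡ suc (length (filter Q? xs))
  length-filter-except {x} {x ∷ xs} (x∉ ∷ _) (here refl) Px ¬Qx Q⊆P P⇒Q with P? x | Q? x
  ... | no ¬Px | _      = ⊥-elim (¬Px Px)
  ... | _      | yes Qx = ⊥-elim (¬Qx Qx)
  ... | yes _  | no _   =
    cong (suc ∘ length) (filter-cong-∈ (λ y∈ Py → P⇒Q Py (All.lookup x∉ y∈ ∘ sym)) (λ _ → Q⊆P))
  length-filter-except {x} {y ∷ xs} (y∉ ∷ unique) (there x∈) Px ¬Qx Q⊆P P⇒Q with P? y | Q? y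
  ... | yes Py | no ¬Qy = ⊥-elim (¬Qy (P⇒Q Py (All.lookup y∉ x∈)))
  ... | no ¬Py | yes Qy = ⊥-elim (¬Py (Q⊆P Qy))
  ... | yes _  | yes _  = cong suc (length-filter-except unique x∈ Px ¬Qx Q⊆P P⇒Q)
  ... | no _   | no _   = length-filter-except unique x∈ Px ¬Qx Q⊆P P⇒Q

module Adjacency {N : ℕ} (G : Graph N) where

  infix 4 _~_
  _~_ : Fin N → Fin N → Set
  u ~ w = T (adj G u w)

  ~-sym : ∀ {u w} → u ~ w → w ~ u
  ~-sym {u} {w} = subst T (Graph.sym G u w)

  ~-irrefl : ∀ {u} → ¬ u ~ u
  ~-irrefl {u} = subst T (Graph.irref G u)

  ∈-neighbours : ∀ {v w} → v ~ w → w ∈ filterᵇ (adj G v) (allV N)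
  ∈-neighbours {v} v~w = ∈-filter⁺ (T? ∘ adj G v) (∈-allFin _) v~w

  leaf-neighbour-unique : ∀ {v w w′} → valence G v ≡ 1 → v ~ w → v ~ w′ → w ≡ w′
  leaf-neighbour-unique v-leaf v~w v~w′ = ∈-length≡1⇒≡ v-leaf (∈-neighbours v~w) (∈-neighbours v~w′)

  within2ᵇ⁻ : ∀ {v w} → T (within2ᵇ G v w) → v ≡ w ⊎ v ~ w ⊎ ∃ λ z → v ~ z × z ~ w
  within2ᵇ⁻ {v} {w} t with v ≟ w | adj G v w
  ... | yes v≡w | _     = inj₁ v≡w
  ... | no _    | true  = inj₂ (inj₁ tt)
  ... | no _    | false with z , v~z∧z~w ← satisfied (any⁻ (λ z → adj G v z ∧ adj G z w) (allV N) t) =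
    inj₂ (inj₂ (z , Equivalence.to T-∧ v~z∧z~w))

  within2ᵇ-path : ∀ {v z w} → v ~ z → z ~ w → T (within2ᵇ G v w)
  within2ᵇ-path {v} {z} {w} v~z z~w with v ≟ w | adj G v w
  ... | yes _ | _     = tt
  ... | no _  | true  = tt
  ... | no _  | false =
    any⁺ (λ z → adj G v z ∧ adj G z w) (lose (∈-allFin z) (Equivalence.from T-∧ (v~z , z~w)))

  lastOf-closed : {S : Pred (Fin N) ℓ} → (∀ {x y} → S x → x ~ y → S y) →
                  ∀ {u} xs → S u → Chain G (u ∷ xs) → S (lastOf G u xs)
  lastOf-closed closed []       Su _           = Su
  lastOf-closed closed (x ∷ xs) Su (u~x , chain) = lastOf-closed closed xs (closed Su u~x) chain

  Chain-truncate : ∀ xs {z ys} → Chain G (xs ++ z ∷ ys) → Chain G (xs ++ z ∷ [])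
  Chain-truncate []            _              = tt
  Chain-truncate (x ∷ [])      (x~z , _)      = x~z , tt
  Chain-truncate (x ∷ x′ ∷ xs) (x~x′ , chain) = x~x′ , Chain-truncate (x′ ∷ xs) chain

  chord⇒cycle : ∀ {x y z rest} → Unique (x ∷ y ∷ rest) → Chain G (x ∷ y ∷ rest) →
                z ∈ rest → x ~ z → HasCycle G
  chord⇒cycle {x} {y} {z} unique chain z∈rest x~z with A , _ , refl ← ∈-∃++ z∈rest =
    z , x ∷ y ∷ A , Unique-prefix (x ∷ y ∷ A) unique , s≤s (s≤s z≤n) ,
    ~-sym x~z , Chain-truncate (x ∷ y ∷ A) chain

module _ {n N : ℕ} (G : Graph N) (n≥2 : 2 ≤ n)
         (valence-1-or-n : ∀ v → valence G v ≡ 1 ⊎ valence G v ≡ n) where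

  open import Data.List.Membership.DecPropositional (_≟_ {N}) using (_∈?_)
  open Adjacency G

  Leaf Internal : Fin N → Set
  Leaf     v = valence G v ≡ 1
  Internal v = valence G v ≡ n

  internalᵇ : Fin N → Bool
  internalᵇ v = valence G v ≡ᵇ n

  internal⇒¬leaf : ∀ {v} → Internal v → ¬ Leaf v
  internal⇒¬leaf v-internal v-leaf = <⇒≢ n≥2 (trans (sym v-leaf) v-internal)

  ¬internal⇒leaf : ∀ {v} → ¬ Internal v → Leaf v
  ¬internal⇒leaf {v} ¬internal with valence-1-or-n v
  ... | inj₁ v-leaf     = v-leaf
  ... | inj₂ v-internal = ⊥-elim (¬internal v-internal)

  -- p is a leaf of the subtree spanned by the internal vertices.
  record PendantInternal : Set where
    field
      p q                     : Fin N
      p~q                     : p ~ q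
      p-internal              : Internal p
      q-internal              : Internal q
      internal-neighbour-is-q : ∀ {y} → p ~ y → Internal y → y ≡ q

  -- The path cur, prev, rest (newest vertex first) is simple, hence has at most N vertices;
  -- slack bounds the number of further extensions.
  walk-internal : (acyclic : ¬ HasCycle G) (slack : ℕ) (cur prev : Fin N) (rest : List (Fin N)) →
           Unique (cur ∷ prev ∷ rest) → Chain G (cur ∷ prev ∷ rest) →
           Internal cur → Internal prev → N ≤ slack + length rest → PendantInternal
  walk-internal acyclic slack cur prev rest unique chain cur-internal prev-internal bound
    with any? (λ y → T? (adj G cur y) ×-dec (valence G y ℕ.≟ n) ×-dec ¬? (y ≟ prev))
  ... | no ∄ = record
    { p~q = proj₁ chain ; p-internal = cur-internal ; q-internal = prev-internal
    ; internal-neighbour-is-q = λ {y} cur~y y-internal →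
        decidable-stable (y ≟ prev) (λ y≢prev → ∄ (y , cur~y , y-internal , y≢prev)) }
  ... | yes (y , cur~y , y-internal , y≢prev) with y ∈? (cur ∷ prev ∷ rest)
  ...   | yes (here refl)            = ⊥-elim (~-irrefl cur~y)
  ...   | yes (there (here y≡prev))  = ⊥-elim (y≢prev y≡prev)
  ...   | yes (there (there y∈rest)) = ⊥-elim (acyclic (chord⇒cycle unique chain y∈rest cur~y))
  ...   | no y∉path with slack | ¬Any⇒All¬ _ y∉path ∷ unique
  ...     | zero      | longer = ⊥-elim (1+n≰n (≤-trans (m+n≤o⇒n≤o 2 (Unique⇒length≤ longer)) bound))
  ...     | suc slack | longer = walk-internal acyclic slack y cur (prev ∷ rest) longer
                          (~-sym cur~y , chain) y-internal cur-internal
                          (subst (N ≤_) (sym (+-suc slack (length rest))) bound)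

  neighbourhood-closed : ∀ {a} → (∀ {y} → a ~ y → ¬ Internal y) →
                         ∀ {x y} → x ≡ a ⊎ a ~ x → x ~ y → y ≡ a ⊎ a ~ y
  neighbourhood-closed _        (inj₁ refl) a~y = inj₂ a~y
  neighbourhood-closed all-leaf (inj₂ a~x)  x~y =
    inj₁ (leaf-neighbour-unique (¬internal⇒leaf (all-leaf a~x)) x~y (~-sym a~x))

  internal-neighbour : Connected G → ∀ {a b} → Internal b → a ≢ b → ∃ λ y → a ~ y × Internal y
  internal-neighbour connected {a} {b} b-internal a≢b
    with any? (λ y → T? (adj G a y) ×-dec (valence G y ℕ.≟ n))
  ... | yes found = found
  ... | no ∄ with xs , chain , refl ← connected a b
    with lastOf-closed (neighbourhood-closed (λ a~y y-internal → ∄ (_ , a~y , y-internal)))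
                         xs (inj₁ refl) chain
  ... | inj₁ b≡a = ⊥-elim (a≢b (sym b≡a))
  ... | inj₂ a~b = ⊥-elim (∄ (_ , a~b , b-internal))

  two-internal : 2 ≤ length (filterᵇ internalᵇ (allV N)) → ∃₂ λ a b → a ≢ b × Internal a × Internal b
  two-internal two with a , b , a≢b , a∈ , b∈ ← Unique-two (filter⁺ _ (allFin⁺ N)) two =
    a , b , a≢b , internal a∈ , internal b∈
    where
    internal : ∀ {x} → x ∈ filterᵇ internalᵇ (allV N) → Internal x
    internal x∈ = ≡ᵇ⇒≡ _ _ (proj₂ (∈-filter⁻ (T? ∘ internalᵇ) {xs = allV N} x∈))

  pendant-internal : Connected G → ¬ HasCycle G →
                     2 ≤ length (filterᵇ internalᵇ (allV N)) → PendantInternal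
  pendant-internal connected acyclic two-internal-vertices
    with a , b , a≢b , a-internal , b-internal ← two-internal two-internal-vertices
    with y , a~y , y-internal ← internal-neighbour connected b-internal a≢b =
    walk-internal acyclic N y a [] ((y≢a ∷ []) ∷ [] ∷ []) (~-sym a~y , tt) y-internal a-internal (m≤m+n N 0)
    where
    y≢a : y ≢ a
    y≢a refl = ~-irrefl a~y

  module _ (pendant : PendantInternal) where

    open PendantInternal pendant

    leaf-neighbourᵇ : Fin N → Bool
    leaf-neighbourᵇ w = isExternalᵇ G w ∧ adj G p w

    leaf-neighbours-length : length (filterᵇ leaf-neighbourᵇ (allV N)) ≡ n ∸ 1
    leaf-neighbours-length =
      cong (_∸ 1) (sym (trans (sym p-internal) (length-filter-except (T? ∘ adj G p) (T? ∘ leaf-neighbourᵇ)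
        (allFin⁺ N) (∈-allFin q) p~q q-not-leaf-neighbour leaf-neighbour⇒neighbour neighbour⇒leaf-neighbour)))
      where
      q-not-leaf-neighbour : ¬ T (leaf-neighbourᵇ q)
      q-not-leaf-neighbour t = internal⇒¬leaf q-internal (≡ᵇ⇒≡ _ 1 (proj₁ (Equivalence.to T-∧ t)))
      leaf-neighbour⇒neighbour : ∀ {y} → T (leaf-neighbourᵇ y) → p ~ y
      leaf-neighbour⇒neighbour = proj₂ ∘ Equivalence.to T-∧
      neighbour⇒leaf-neighbour : ∀ {y} → p ~ y → y ≢ q → T (leaf-neighbourᵇ y)
      neighbour⇒leaf-neighbour p~y y≢q = Equivalence.from T-∧
        (≡⇒≡ᵇ _ 1 (¬internal⇒leaf (y≢q ∘ internal-neighbour-is-q p~y)) , p~y)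

    within2⇔adj : ∀ {v w} → Leaf v → v ~ p → Leaf w → T (within2ᵇ G v w) ⇔ p ~ w
    within2⇔adj {v} {w} v-leaf v~p w-leaf = mk⇔ to (within2ᵇ-path v~p)
      where
      to : T (within2ᵇ G v w) → p ~ w
      to t with within2ᵇ⁻ {v} {w} t
      ... | inj₁ refl                    = ~-sym v~p
      ... | inj₂ (inj₁ v~w)              = ⊥-elim (internal⇒¬leaf p-internal
                                             (subst Leaf (leaf-neighbour-unique v-leaf v~w v~p) w-leaf))
      ... | inj₂ (inj₂ (z , v~z , z~w)) = subst (_~ w) (leaf-neighbour-unique v-leaf v~z v~p) z~w

    Two≡leaf-neighbours : ∀ {v} → Leaf v → v ~ p → Two G v ≡ filterᵇ leaf-neighbourᵇ (allV N)
    Two≡leaf-neighbours {v} v-leaf v~p =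
      filter-≐ (T? ∘ λ w → isExternalᵇ G w ∧ within2ᵇ G v w) (T? ∘ leaf-neighbourᵇ) (to , from) (allV N)
      where
      to : ∀ {w} → T (isExternalᵇ G w ∧ within2ᵇ G v w) → T (leaf-neighbourᵇ w)
      to t with w-leaf , v-near-w ← Equivalence.to T-∧ t =
        Equivalence.from T-∧ (w-leaf , Equivalence.to (within2⇔adj v-leaf v~p (≡ᵇ⇒≡ _ 1 w-leaf)) v-near-w)
      from : ∀ {w} → T (leaf-neighbourᵇ w) → T (isExternalᵇ G w ∧ within2ᵇ G v w)
      from t with w-leaf , p~w ← Equivalence.to T-∧ t =
        Equivalence.from T-∧ (w-leaf , Equivalence.from (within2⇔adj v-leaf v~p (≡ᵇ⇒≡ _ 1 w-leaf)) p~w)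

    leaf-neighbour : ∃ λ v → Leaf v × v ~ p
    leaf-neighbour
      with v , v∈ ← length>0⇒∈ (subst (0 <_) (sym leaf-neighbours-length) (∸-monoˡ-≤ 1 n≥2))
      with v-leaf , p~v ← Equivalence.to T-∧ (proj₂ (∈-filter⁻ (T? ∘ leaf-neighbourᵇ) {xs = allV N} v∈)) =
      v , ≡ᵇ⇒≡ _ 1 v-leaf , ~-sym p~v

    leaf-with-length-Two≡n∸1 : Σ (Fin N) λ v → Leaf v × length (Two G v) ≡ n ∸ 1
    leaf-with-length-Two≡n∸1 with v , v-leaf , v~p ← leaf-neighbour =
      v , v-leaf , trans (cong length (Two≡leaf-neighbours v-leaf v~p)) leaf-neighbours-length

lemma3p11 : (n m N : ℕ) (G : Graph N) → 2 ≤ n → 1 < m → InBi G m n →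
    Σ (Fin N) λ v → valence G v ≡ 1 × length (Two G v) ≡ n ∸ 1
lemma3p11 n m N G n≥2 m>1 ((connected , acyclic) , valence-1-or-n , #internal≡m) =
  leaf-with-length-Two≡n∸1 G n≥2 valence-1-or-n
    (pendant-internal G n≥2 valence-1-or-n connected acyclic (subst (2 ≤_) (sym #internal≡m) m>1))
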